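{- Let $A$ be a thin groupoid. Then: (a) if a morphism $\theta:a\to a'$ of $A$ lies in both $A_-$ and $A_+$, then $a=a'$ and $\theta=\mathrm{id}_a$; (b) for every morphism $\theta:a\to a'$ of $A$ there exist a unique object $a''$ and unique morphisms $\theta_-:a\to a''$ in $A_-$ and $\theta_+:a''\to a'$ in $A_+$ such that $\theta=\theta_+\circ\theta_-$.
   Context: All groupoids are small. Prestrategies and bipullbacks. A prestrategy on $A$ is $(S,\partial^S:S\to A)$. For a cospan $S\xrightarrow{u}B\xleftarrow{v}T$ of groupoids: - a pseudocone with vertex $X$ is $(l',r',\nu:ul'\Rightarrow vr')$; - a morphism of pseudocones is $(\alpha,\beta)$ with $\nu''\circ u\alpha=v\beta\circ\nu$; - $(P,l,r,\mu)$ is a bipullback if for every $X$, $h\mapsto(lh,rh,\mu h)$ is an equivalence from functors $X\to P$ to pseudocones with vertex $X$; - commuting squares carry identity $2$-cells. Uniform structure. $S\perp T$ iff the pullback of $S\to A\leftarrow T$ is a bipullback, with $\mathbf{S}^\perp=\{T\mid\forall S\in\mathbf{S},S\perp T\}$. A uniform groupoid is $(A,\mathbf{U}_A)$ with $\mathbf{U}_A^{\perp\perp}=\mathbf{U}_A$. Thin structure. For $S\in\mathbf{U}_A$ and $T\in\mathbf{U}_A^\perp$, $S\perp_{\mathrm{th}}T$ iff the pullback of $S\to A\leftarrow T$ is discrete (only identity morphisms). For $\mathbf{S}\subseteq\mathbf{U}_A$, $\mathbf{S}^{\perp_{\mathrm{th}}}=\{T\in\mathbf{U}_A^\perp\mid\forall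 S\in\mathbf{S},S\perp_{\mathrm{th}}T\}$; for $\mathbf{V}\subseteq\mathbf{U}_A^\perp$, $\mathbf{V}^{\perp_{\mathrm{th}}}=\{S\in\mathbf{U}_A\mid\forall T\in\mathbf{V},S\perp_{\mathrm{th}}T\}$. A thin groupoid is a groupoid $A$ together with: - two subgroupoids $A_-,A_+$ each containing all objects of $A$, - a class $\mathbf{U}_A$ making $(A,\mathbf{U}_A)$ a uniform groupoid, and - $\mathbf{T}_A\subseteq\mathbf{U}_A$ with $\mathbf{T}_A^{\perp_{\mathrm{th}}\perp_{\mathrm{th}}}=\mathbf{T}_A$, $(A_-,\text{inclusion})\in\mathbf{T}_A$ and $(A_+,\text{inclusion})\in\mathbf{T}_A^{\perp_{\mathrm{th}}}$. -}

module Defs where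

open import Level using (Level)
open import Data.Product using (Σ; _×_; _,_; proj₁; proj₂)
open import Relation.Binary.PropositionalEquality
  using (_≡_; refl; sym; trans; cong; cong₂; subst; subst₂)
open import Axiom.UniquenessOfIdentityProofs using (UIP; module Constant⇒UIP)

Σ-mk : ∀ {A : Set} {B : A → Set} {a a' : A} {b : B a} {b' : B a'} →
       (q : a ≡ a') → subst B q b ≡ b' → _≡_ {A = Σ A B} (a , b) (a' , b')
Σ-mk refl refl = refl

Σ-UIP : ∀ {A : Set} {B : A → Set} → UIP A → (∀ {a} → UIP (B a)) → UIP (Σ A B)
Σ-UIP {A} {B} uA uB = Constant⇒UIP.≡-irrelevant norm norm-const
  where
  q₂ : ∀ {x y : Σ A B} (p : x ≡ y) → subst B (cong proj₁ p) (proj₂ x) ≡ proj₂ y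
  q₂ refl = refl
  norm : ∀ {x y : Σ A B} → x ≡ y → x ≡ y
  norm p = Σ-mk (cong proj₁ p) (q₂ p)
  mk-const : ∀ {a a' : A} {b : B a} {b' : B a'} (q q' : a ≡ a')
             (r : subst B q b ≡ b') (r' : subst B q' b ≡ b') →
             Σ-mk {B = B} q r ≡ Σ-mk q' r'
  mk-const q q' r r' with uA q q'
  ... | refl with uB r r'
  ... | refl = refl
  norm-const : ∀ {x y : Σ A B} (p p' : x ≡ y) → norm p ≡ norm p'
  norm-const p p' = mk-const _ _ (q₂ p) (q₂ p')

Prop⇒UIP : ∀ {P : Set} → (∀ (x y : P) → x ≡ y) → UIP P
Prop⇒UIP {P} isP = Constant⇒UIP.≡-irrelevant f (λ _ _ → refl)
  where
  f : ∀ {x y : P} → x ≡ y → x ≡ y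
  f {x} {y} _ = trans (sym (isP x x)) (isP x y)

UIP-≡ : ∀ {A : Set} → UIP A → ∀ {x y : A} → UIP (x ≡ y)
UIP-≡ uA = Prop⇒UIP uA

record Groupoid : Set₁ where
  infixr 9 _∘_
  field
    Obj   : Set
    Hom   : Obj → Obj → Set
    id    : (x : Obj) → Hom x x
    _∘_   : ∀ {x y z} → Hom y z → Hom x y → Hom x z
    inv   : ∀ {x y} → Hom x y → Hom y x
    idˡ   : ∀ {x y} (f : Hom x y) → id y ∘ f ≡ f
    idʳ   : ∀ {x y} (f : Hom x y) → f ∘ id x ≡ f
    assoc : ∀ {w x y z} (f : Hom w x) (g : Hom x y) (h : Hom y z) →
            (h ∘ g) ∘ f ≡ h ∘ (g ∘ f)
    invˡ  : ∀ {x y} (f : Hom x y) → inv f ∘ f ≡ id x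
    invʳ  : ∀ {x y} (f : Hom x y) → f ∘ inv f ≡ id y
    Obj-set : UIP Obj
    Hom-set : ∀ {x y} → UIP (Hom x y)

  inv-unique : ∀ {x y} (g : Hom y x) (h : Hom x y) → g ∘ h ≡ id x → g ≡ inv h
  inv-unique g h e =
    trans (sym (idʳ g))
    (trans (cong (g ∘_) (sym (invʳ h)))
    (trans (sym (assoc (inv h) h g))
    (trans (cong (_∘ inv h) e) (idˡ (inv h)))))

open Groupoid

record Functor (C D : Groupoid) : Set where
  field
    F₀   : Obj C → Obj D
    F₁   : ∀ {x y} → Hom C x y → Hom D (F₀ x) (F₀ y)
    F-id : ∀ x → F₁ (id C x) ≡ id D (F₀ x)
    F-∘  : ∀ {x y z} (g : Hom C y z) (f : Hom C x y) →
           F₁ (_∘_ C g f) ≡ _∘_ D (F₁ g) (F₁ f)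

open Functor

_∘F_ : ∀ {X Y Z} → Functor Y Z → Functor X Y → Functor X Z
_∘F_ {Z = Z} G F = record
  { F₀ = λ x → F₀ G (F₀ F x)
  ; F₁ = λ f → F₁ G (F₁ F f)
  ; F-id = λ x → trans (cong (F₁ G) (F-id F x)) (F-id G _)
  ; F-∘ = λ g f → trans (cong (F₁ G) (F-∘ F g f)) (F-∘ G _ _)
  }

record NatTrans {C D : Groupoid} (F G : Functor C D) : Set where
  field
    η       : ∀ x → Hom D (F₀ F x) (F₀ G x)
    natural : ∀ {x y} (f : Hom C x y) →
              _∘_ D (η y) (F₁ F f) ≡ _∘_ D (F₁ G f) (η x)

open NatTrans

_▹_ : ∀ {X Y Z} (K : Functor Y Z) {G H : Functor X Y} →
      NatTrans G H → NatTrans (K ∘F G) (K ∘F H)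
K ▹ α = record
  { η = λ x → F₁ K (η α x)
  ; natural = λ f → trans (sym (F-∘ K _ _))
                  (trans (cong (F₁ K) (natural α f)) (F-∘ K _ _))
  }

module _ {S T B : Groupoid} (u : Functor S B) (v : Functor T B) where

  record PseudoCone (X : Groupoid) : Set where
    field
      l′ : Functor X S
      r′ : Functor X T
      ν  : NatTrans (u ∘F l′) (v ∘F r′)

  open PseudoCone

  record ConeMor {X : Groupoid} (c c′ : PseudoCone X) : Set where
    field
      α   : NatTrans (l′ c) (l′ c′)
      β   : NatTrans (r′ c) (r′ c′)
      coh : ∀ x → _∘_ B (η (ν c′) x) (F₁ u (η α x))
                  ≡ _∘_ B (F₁ v (η β x)) (η (ν c) x)

  open ConeMor

  module _ {P : Groupoid} (l : Functor P S) (r : Functor P T)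
           (μ : NatTrans (u ∘F l) (v ∘F r)) where

    coneOf : ∀ {X} → Functor X P → PseudoCone X
    coneOf h = record
      { l′ = l ∘F h ; r′ = r ∘F h
      ; ν = record { η = λ x → η μ (F₀ h x) ; natural = λ f → natural μ (F₁ h f) } }

    coneMorOf : ∀ {X} {h h′ : Functor X P} → NatTrans h h′ →
                ConeMor (coneOf h) (coneOf h′)
    coneMorOf θ = record
      { α = l ▹ θ ; β = r ▹ θ ; coh = λ x → natural μ (η θ x) }

    -- (P, l, r, μ) is a bipullback: for every X, the functor
    -- h ↦ (lh, rh, μh) from [X, P] to pseudocones with vertex X is an
    -- equivalence (faithful, full, essentially surjective).
    IsBipullback : Set₁
    IsBipullback = (X : Groupoid) →
        (∀ {h h′ : Functor X P} (θ θ′ : NatTrans h h′) →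
           (∀ x → F₁ l (η θ x) ≡ F₁ l (η θ′ x)) →
           (∀ x → F₁ r (η θ x) ≡ F₁ r (η θ′ x)) →
           ∀ x → η θ x ≡ η θ′ x)
      × (∀ {h h′ : Functor X P} (m : ConeMor (coneOf h) (coneOf h′)) →
           Σ (NatTrans h h′) λ θ →
             (∀ x → F₁ l (η θ x) ≡ η (α m) x) × (∀ x → F₁ r (η θ x) ≡ η (β m) x))
      × (∀ (c : PseudoCone X) → Σ (Functor X P) λ h → ConeMor (coneOf h) c)

module Pullback {S T A : Groupoid} (F : Functor S A) (G : Functor T A) where

  PObj : Set
  PObj = Σ (Obj S × Obj T) λ st → F₀ F (proj₁ st) ≡ F₀ G (proj₂ st)

  PHom : PObj → PObj → Set
  PHom ((s , t) , p) ((s′ , t′) , p′) =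
    Σ (Hom S s s′ × Hom T t t′) λ fg →
      subst₂ (Hom A) p p′ (F₁ F (proj₁ fg)) ≡ F₁ G (proj₂ fg)

  private
    subst₂-id : ∀ {a b} (p : a ≡ b) → subst₂ (Hom A) p p (id A a) ≡ id A b
    subst₂-id refl = refl

    subst₂-∘ : ∀ {a b c a′ b′ c′} (p : a ≡ a′) (q : b ≡ b′) (r : c ≡ c′)
               (g : Hom A b c) (f : Hom A a b) →
               subst₂ (Hom A) p r (_∘_ A g f)
               ≡ _∘_ A (subst₂ (Hom A) q r g) (subst₂ (Hom A) p q f)
    subst₂-∘ refl refl refl g f = refl

    subst₂-inv : ∀ {a b a′ b′} (p : a ≡ a′) (q : b ≡ b′) (f : Hom A a b) →
                 subst₂ (Hom A) q p (inv A f) ≡ inv A (subst₂ (Hom A) p q f)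
    subst₂-inv refl refl f = refl

    F-inv : ∀ {C D : Groupoid} (K : Functor C D) {x y} (f : Hom C x y) →
            F₁ K (inv C f) ≡ inv D (F₁ K f)
    F-inv {C} {D} K f = inv-unique D _ _
      (trans (sym (F-∘ K _ _)) (trans (cong (F₁ K) (invˡ C f)) (F-id K _)))

    PHom-≡ : ∀ {x y} {φ ψ : PHom x y} →
             proj₁ (proj₁ φ) ≡ proj₁ (proj₁ ψ) → proj₂ (proj₁ φ) ≡ proj₂ (proj₁ ψ) → φ ≡ ψ
    PHom-≡ {φ = (f , g) , e} {(.f , .g) , e′} refl refl =
      cong (λ k → (f , g) , k) (Hom-set A e e′)

    ×-UIP : ∀ {X Y : Set} → UIP X → UIP Y → UIP (X × Y)
    ×-UIP uX uY = Σ-UIP uX uY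

  P : Groupoid
  P = record
    { Obj = PObj
    ; Hom = PHom
    ; id = λ { ((s , t) , p) → (id S s , id T t) ,
               trans (cong (subst₂ (Hom A) p p) (F-id F s))
                 (trans (subst₂-id p) (sym (F-id G t))) }
    ; _∘_ = λ { {(_ , p)} {(_ , q)} {(_ , r)} ((g , g′) , e₂) ((f , f′) , e₁) →
               (_∘_ S g f , _∘_ T g′ f′) ,
               trans (cong (subst₂ (Hom A) p r) (F-∘ F g f))
               (trans (subst₂-∘ p q r _ _)
               (trans (cong₂ (_∘_ A) e₂ e₁) (sym (F-∘ G g′ f′)))) }
    ; inv = λ { {(_ , p)} {(_ , q)} ((f , f′) , e) →
               (inv S f , inv T f′) ,
               trans (cong (subst₂ (Hom A) q p) (F-inv F f))
               (trans (subst₂-inv p q _)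
               (trans (cong (inv A) e) (sym (F-inv G f′)))) }
    ; idˡ = λ φ → PHom-≡ (idˡ S _) (idˡ T _)
    ; idʳ = λ φ → PHom-≡ (idʳ S _) (idʳ T _)
    ; assoc = λ f g h → PHom-≡ (assoc S _ _ _) (assoc T _ _ _)
    ; invˡ = λ φ → PHom-≡ (invˡ S _) (invˡ T _)
    ; invʳ = λ φ → PHom-≡ (invʳ S _) (invʳ T _)
    ; Obj-set = Σ-UIP (×-UIP (Obj-set S) (Obj-set T)) (UIP-≡ (Obj-set A))
    ; Hom-set = Σ-UIP (×-UIP (Hom-set S) (Hom-set T)) (UIP-≡ (Hom-set A))
    }

  π₁ : Functor P S
  π₁ = record { F₀ = λ x → proj₁ (proj₁ x) ; F₁ = λ φ → proj₁ (proj₁ φ)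
              ; F-id = λ _ → refl ; F-∘ = λ _ _ → refl }

  π₂ : Functor P T
  π₂ = record { F₀ = λ x → proj₂ (proj₁ x) ; F₁ = λ φ → proj₂ (proj₁ φ)
              ; F-id = λ _ → refl ; F-∘ = λ _ _ → refl }

  private
    idcell : ∀ {a b} → a ≡ b → Hom A a b
    idcell {a} p = subst (Hom A a) p (id A a)

    idcell-nat : ∀ {a b a′ b′} (p : a ≡ b) (p′ : a′ ≡ b′) (f : Hom A a a′) →
                 _∘_ A (idcell p′) f ≡ _∘_ A (subst₂ (Hom A) p p′ f) (idcell p)
    idcell-nat refl refl f = trans (idˡ A f) (sym (idʳ A f))

  μ : NatTrans (F ∘F π₁) (G ∘F π₂)
  μ = record
    { η = λ x → idcell (proj₂ x)
    ; natural = λ { {(_ , p)} {(_ , p′)} ((f , g) , e) →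
        trans (idcell-nat p p′ (F₁ F f)) (cong (λ k → _∘_ A k (idcell p)) e) }
    }

record Prestrategy (A : Groupoid) : Set₁ where
  constructor prestrategy
  field
    St : Groupoid
    ∂  : Functor St A

open Prestrategy

Class : Groupoid → Set₂
Class A = Prestrategy A → Set₁

PB : ∀ {A} → Prestrategy A → Prestrategy A → Groupoid
PB S T = Pullback.P (∂ S) (∂ T)

_⊥_ : ∀ {A} → Prestrategy A → Prestrategy A → Set₁
S ⊥ T = IsBipullback (∂ S) (∂ T) (Pullback.π₁ (∂ S) (∂ T))
          (Pullback.π₂ (∂ S) (∂ T)) (Pullback.μ (∂ S) (∂ T))

_^⊥ : ∀ {A} → Class A → Class A
(𝐒 ^⊥) T = ∀ S → 𝐒 S → S ⊥ T

_≐_ : ∀ {A} → Class A → Class A → Set₁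
𝐒 ≐ 𝐒′ = ∀ S → (𝐒 S → 𝐒′ S) × (𝐒′ S → 𝐒 S)

Discrete : Groupoid → Set
Discrete G = ∀ {x y} (f : Hom G x y) →
  _≡_ {A = Σ (Obj G) (Hom G x)} (y , f) (x , id G x)

_⊥th_ : ∀ {A} → Prestrategy A → Prestrategy A → Set
S ⊥th T = Discrete (PB S T)

module Thin {A : Groupoid} (𝐔 : Class A) where
  -- for 𝐒 ⊆ 𝐔 :  𝐒^⊥th = { T ∈ 𝐔^⊥ | ∀ S ∈ 𝐒, S ⊥th T }
  _^⊥thL : Class A → Class A
  (𝐒 ^⊥thL) T = (𝐔 ^⊥) T × (∀ S → 𝐒 S → S ⊥th T)
  -- for 𝐕 ⊆ 𝐔^⊥ :  𝐕^⊥th = { S ∈ 𝐔 | ∀ T ∈ 𝐕, S ⊥th T }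
  _^⊥thR : Class A → Class A
  (𝐕 ^⊥thR) S = 𝐔 S × (∀ T → 𝐕 T → S ⊥th T)

record Subgroupoid (A : Groupoid) : Set₁ where
  field
    mem      : ∀ {x y} → Hom A x y → Set
    mem-prop : ∀ {x y} {f : Hom A x y} (p q : mem f) → p ≡ q
    mem-id   : ∀ x → mem (id A x)
    mem-∘    : ∀ {x y z} {g : Hom A y z} {f : Hom A x y} →
               mem g → mem f → mem (_∘_ A g f)
    mem-inv  : ∀ {x y} {f : Hom A x y} → mem f → mem (inv A f)

open Subgroupoid

subPre : ∀ {A} → Subgroupoid A → Prestrategy A
subPre {A} B = prestrategy G incl
  where
  ≡-sub : ∀ {x y} {φ ψ : Σ (Hom A x y) (mem B)} → proj₁ φ ≡ proj₁ ψ → φ ≡ ψ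
  ≡-sub {φ = f , m} {.f , m′} refl = cong (f ,_) (mem-prop B m m′)
  G : Groupoid
  G = record
    { Obj = Obj A
    ; Hom = λ x y → Σ (Hom A x y) (mem B)
    ; id = λ x → id A x , mem-id B x
    ; _∘_ = λ g f → _∘_ A (proj₁ g) (proj₁ f) , mem-∘ B (proj₂ g) (proj₂ f)
    ; inv = λ f → inv A (proj₁ f) , mem-inv B (proj₂ f)
    ; idˡ = λ f → ≡-sub (idˡ A _)
    ; idʳ = λ f → ≡-sub (idʳ A _)
    ; assoc = λ f g h → ≡-sub (assoc A _ _ _)
    ; invˡ = λ f → ≡-sub (invˡ A _)
    ; invʳ = λ f → ≡-sub (invʳ A _)
    ; Obj-set = Obj-set A
    ; Hom-set = Σ-UIP (Hom-set A) (Prop⇒UIP (mem-prop B))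
    }
  incl : Functor G A
  incl = record { F₀ = λ x → x ; F₁ = proj₁ ; F-id = λ _ → refl ; F-∘ = λ _ _ → refl }

record ThinGroupoid : Set₂ where
  field
    A       : Groupoid
    A₋      : Subgroupoid A
    A₊      : Subgroupoid A
    𝐔       : Class A
    𝐔-bi    : ((𝐔 ^⊥) ^⊥) ≐ 𝐔
    𝐓       : Class A
    𝐓⊆𝐔     : ∀ S → 𝐓 S → 𝐔 S
  open Thin 𝐔
  field
    𝐓-bi    : ((𝐓 ^⊥thL) ^⊥thR) ≐ 𝐓
    A₋∈𝐓    : 𝐓 (subPre A₋)
    A₊∈𝐓⊥   : (𝐓 ^⊥thL) (subPre A₊)

{-# OPTIONS --safe #-}
module Submission where

open import Defs
open import Data.Product using (Σ; _×_; _,_; proj₁; proj₂)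
open import Data.Unit using (⊤; tt)
open import Relation.Binary.PropositionalEquality
  using (_≡_; refl; sym; trans; cong; cong₂; subst; module ≡-Reasoning)

-- Only two consequences of thinness are used: A₋ ⊥ A₊ and A₋ ⊥th A₊.
-- Essential surjectivity of the bipullback, applied to the pseudocone over
-- the terminal groupoid given by θ : a → a′, yields an object (s , s) of the
-- strict pullback and maps α : s → a in A₋, β : s → a′ in A₊ with
-- θ ∘ α = β; hence θ = β ∘ α⁻¹.  Discreteness of the strict pullback says
-- that a morphism lying in both A₋ and A₊ is an identity, and two
-- factorisations differ by such a morphism φ₊⁻¹ ∘ θ₊ = φ₋ ∘ θ₋⁻¹.

module GroupoidProperties (G : Groupoid) where
  open Groupoid G
  open ≡-Reasoning

  inv-cancelˡ : ∀ {x y z} (f : Hom x y) (g : Hom z x) → inv f ∘ (f ∘ g) ≡ g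
  inv-cancelˡ f g = begin
    inv f ∘ (f ∘ g)  ≡⟨ assoc g f (inv f) ⟨
    (inv f ∘ f) ∘ g  ≡⟨ cong (_∘ g) (invˡ f) ⟩
    id _ ∘ g         ≡⟨ idˡ g ⟩
    g                ∎

  inv-cancelʳ : ∀ {x y z} (f : Hom y x) (g : Hom z x) → f ∘ (inv f ∘ g) ≡ g
  inv-cancelʳ f g = begin
    f ∘ (inv f ∘ g)  ≡⟨ assoc g (inv f) f ⟨
    (f ∘ inv f) ∘ g  ≡⟨ cong (_∘ g) (invʳ f) ⟩
    id _ ∘ g         ≡⟨ idˡ g ⟩
    g                ∎

  transposeʳ : ∀ {x y z} {h : Hom y z} {f : Hom x y} {g : Hom x z} →
               h ∘ f ≡ g → h ≡ g ∘ inv f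
  transposeʳ {h = h} {f} {g} e = begin
    h                  ≡⟨ idʳ h ⟨
    h ∘ id _           ≡⟨ cong (h ∘_) (invʳ f) ⟨
    h ∘ (f ∘ inv f)    ≡⟨ assoc (inv f) f h ⟨
    (h ∘ f) ∘ inv f    ≡⟨ cong (_∘ inv f) e ⟩
    g ∘ inv f          ∎

𝟙 : Groupoid
𝟙 = record
  { Obj = ⊤ ; Hom = λ _ _ → ⊤ ; id = λ _ → tt ; _∘_ = λ _ _ → tt ; inv = λ _ → tt
  ; idˡ = λ _ → refl ; idʳ = λ _ → refl ; assoc = λ _ _ _ → refl
  ; invˡ = λ _ → refl ; invʳ = λ _ → refl
  ; Obj-set = Prop⇒UIP (λ _ _ → refl) ; Hom-set = Prop⇒UIP (λ _ _ → refl) }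

const : (G : Groupoid) → Groupoid.Obj G → Functor 𝟙 G
const G x = record
  { F₀ = λ _ → x ; F₁ = λ _ → Groupoid.id G x
  ; F-id = λ _ → refl ; F-∘ = λ _ _ → sym (Groupoid.idˡ G _) }

module WideSubgroupoids {A : Groupoid} (B₋ B₊ : Subgroupoid A) where
  open Groupoid A
  open GroupoidProperties A
  open Subgroupoid B₋ renaming (mem to In₋; mem-∘ to In₋-∘; mem-inv to In₋-inv)
  open Subgroupoid B₊ renaming (mem to In₊; mem-∘ to In₊-∘; mem-inv to In₊-inv)

  IntersectionTrivial : Set
  IntersectionTrivial = ∀ {a a′} (θ : Hom a a′) → In₋ θ → In₊ θ →
    _≡_ {A = Σ Obj (Hom a)} (a′ , θ) (a , id a)

  Factorisation : ∀ {a a′} → Hom a a′ → Set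
  Factorisation {a} {a′} θ = Σ Obj λ a″ → Σ (Hom a a″) λ θ₋ → Σ (Hom a″ a′) λ θ₊ →
    In₋ θ₋ × In₊ θ₊ × θ ≡ θ₊ ∘ θ₋

  ⊥th⇒intersectionTrivial : subPre B₋ ⊥th subPre B₊ → IntersectionTrivial
  ⊥th⇒intersectionTrivial discrete {a} {a′} θ θ∈₋ θ∈₊ =
    cong (λ z → proj₁ (proj₁ (proj₁ z)) , proj₁ (proj₁ (proj₁ (proj₂ z))))
         (discrete {(a , a) , refl} {(a′ , a′) , refl} (((θ , θ∈₋) , (θ , θ∈₊)) , refl))

  factorisation-unique : IntersectionTrivial →
    ∀ {a a′ a″ b} {θ₋ : Hom a a″} {θ₊ : Hom a″ a′} {φ₋ : Hom a b} {φ₊ : Hom b a′} →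
    In₋ θ₋ → In₊ θ₊ → In₋ φ₋ → In₊ φ₊ → θ₊ ∘ θ₋ ≡ φ₊ ∘ φ₋ →
    _≡_ {A = Σ Obj λ c → Hom a c × Hom c a′} (b , φ₋ , φ₊) (a″ , θ₋ , θ₊)
  factorisation-unique trivial {θ₋ = θ₋} {θ₊} {φ₋} {φ₊} θ₋∈ θ₊∈ φ₋∈ φ₊∈ e =
    collapse (trivial ψ ψ∈₋ ψ∈₊) ψθ₋≡φ₋ φ₊ψ≡θ₊
    where
    ψ = inv φ₊ ∘ θ₊

    ψθ₋≡φ₋ : ψ ∘ θ₋ ≡ φ₋
    ψθ₋≡φ₋ = trans (assoc θ₋ θ₊ (inv φ₊))
               (trans (cong (inv φ₊ ∘_) e) (inv-cancelˡ φ₊ φ₋))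

    φ₊ψ≡θ₊ : φ₊ ∘ ψ ≡ θ₊
    φ₊ψ≡θ₊ = inv-cancelʳ φ₊ θ₊

    ψ∈₊ : In₊ ψ
    ψ∈₊ = In₊-∘ (In₊-inv φ₊∈) θ₊∈

    ψ∈₋ : In₋ ψ
    ψ∈₋ = subst In₋ (sym (transposeʳ ψθ₋≡φ₋)) (In₋-∘ φ₋∈ (In₋-inv θ₋∈))

    collapse : ∀ {a a′ a″ b} {θ₋ : Hom a a″} {θ₊ : Hom a″ a′} {ψ : Hom a″ b}
               {φ₋ : Hom a b} {φ₊ : Hom b a′} →
               _≡_ {A = Σ Obj (Hom a″)} (b , ψ) (a″ , id a″) →
               ψ ∘ θ₋ ≡ φ₋ → φ₊ ∘ ψ ≡ θ₊ →
               _≡_ {A = Σ Obj λ c → Hom a c × Hom c a′} (b , φ₋ , φ₊) (a″ , θ₋ , θ₊)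
    collapse {a″ = a″} {θ₋ = θ₋} {φ₊ = φ₊} refl refl refl =
      cong (a″ ,_) (cong₂ _,_ (idˡ θ₋) (sym (idʳ φ₊)))

  factorisation-from-square : ∀ {a a′ s t} (θ : Hom a a′) (p : s ≡ t)
    {α : Hom s a} {β : Hom t a′} → In₋ α → In₊ β →
    θ ∘ α ≡ β ∘ subst (Hom s) p (id s) → Factorisation θ
  factorisation-from-square θ refl {α} {β} α∈ β∈ square =
    _ , inv α , β , In₋-inv α∈ , β∈ , transposeʳ (trans square (idʳ β))

  ⊥⇒factorisation : subPre B₋ ⊥ subPre B₊ → ∀ {a a′} (θ : Hom a a′) → Factorisation θ
  ⊥⇒factorisation bipullback {a} {a′} θ =
    factorisation-from-square θ (proj₂ (Functor.F₀ h tt))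
      (proj₂ (NatTrans.η α tt)) (proj₂ (NatTrans.η β tt)) (ConeMor.coh m tt)
    where
    cone : PseudoCone (Prestrategy.∂ (subPre B₋)) (Prestrategy.∂ (subPre B₊)) 𝟙
    cone = record
      { l′ = const (Prestrategy.St (subPre B₋)) a
      ; r′ = const (Prestrategy.St (subPre B₊)) a′
      ; ν = record { η = λ _ → θ ; natural = λ _ → trans (idʳ θ) (sym (idˡ θ)) } }
    h = proj₁ (proj₂ (proj₂ (bipullback 𝟙)) cone)
    m = proj₂ (proj₂ (proj₂ (bipullback 𝟙)) cone)
    α = ConeMor.α m
    β = ConeMor.β m

  ⊥⇒unique-factorisation : subPre B₋ ⊥ subPre B₊ → IntersectionTrivial →
    ∀ {a a′} (θ : Hom a a′) →
    Σ Obj λ a″ → Σ (Hom a a″) λ θ₋ → Σ (Hom a″ a′) λ θ₊ →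
      (In₋ θ₋ × In₊ θ₊ × θ ≡ θ₊ ∘ θ₋)
      × (∀ (b : Obj) (φ₋ : Hom a b) (φ₊ : Hom b a′) →
           In₋ φ₋ → In₊ φ₊ → θ ≡ φ₊ ∘ φ₋ →
           _≡_ {A = Σ Obj λ c → Hom a c × Hom c a′} (b , φ₋ , φ₊) (a″ , θ₋ , θ₊))
  ⊥⇒unique-factorisation bipullback trivial θ
    with ⊥⇒factorisation bipullback θ
  ... | a″ , θ₋ , θ₊ , θ₋∈ , θ₊∈ , θ≡ =
    a″ , θ₋ , θ₊ , (θ₋∈ , θ₊∈ , θ≡) ,
    λ _ _ _ φ₋∈ φ₊∈ θ≡′ → factorisation-unique trivial θ₋∈ θ₊∈ φ₋∈ φ₊∈ (trans (sym θ≡) θ≡′)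

lemma3 : (𝔸 : ThinGroupoid) →
    let open ThinGroupoid 𝔸
        open Groupoid A
        open Subgroupoid A₋ renaming (mem to In₋)
        open Subgroupoid A₊ renaming (mem to In₊)
    in
    -- (a) θ in both A₋ and A₊ implies a = a' and θ = id_a
    (∀ {a a′} (θ : Hom a a′) → In₋ θ → In₊ θ →
       _≡_ {A = Σ Obj (Hom a)} (a′ , θ) (a , id a))
    ×
    -- (b) unique factorisation θ = θ₊ ∘ θ₋ with θ₋ ∈ A₋, θ₊ ∈ A₊
    (∀ {a a′} (θ : Hom a a′) →
       Σ Obj λ a″ → Σ (Hom a a″) λ θ₋ → Σ (Hom a″ a′) λ θ₊ →
         (In₋ θ₋ × In₊ θ₊ × θ ≡ θ₊ ∘ θ₋)
         × (∀ (b : Obj) (φ₋ : Hom a b) (φ₊ : Hom b a′) →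
              In₋ φ₋ → In₊ φ₊ → θ ≡ φ₊ ∘ φ₋ →
              _≡_ {A = Σ Obj λ c → Hom a c × Hom c a′} (b , φ₋ , φ₊) (a″ , θ₋ , θ₊)))
lemma3 𝔸 = trivial , ⊥⇒unique-factorisation orthogonal trivial
  where
  open ThinGroupoid 𝔸
  open WideSubgroupoids A₋ A₊

  trivial : IntersectionTrivial
  trivial = ⊥th⇒intersectionTrivial (proj₂ A₊∈𝐓⊥ (subPre A₋) A₋∈𝐓)

  orthogonal : subPre A₋ ⊥ subPre A₊
  orthogonal = proj₁ A₊∈𝐓⊥ (subPre A₋) (𝐓⊆𝐔 (subPre A₋) A₋∈𝐓)
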